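{- Let $G$ be a finite simple graph with a perfect matching. If the perfect matching polytope $PM(G)$ equals the set of all non-negative $1$-regular vectors in $\mathbb{R}^{E(G)}$, then $G\in\mathcal{G}$.
   Context: $PM(G)$ is the convex hull in $\mathbb{R}^{E(G)}$ of the incidence vectors of the perfect matchings of $G$. A vector $x\in\mathbb{R}^{E(G)}$ is $1$-regular if $\sum_{e\ni v}x(e)=1$ for every vertex $v$. $\mathcal{G}$ is the set of finite simple graphs $G$ with a perfect matching which do not contain two vertex-disjoint odd cycles $C,C'$ such that $G-V(C)-V(C')$ has a perfect matching (the empty graph counting as having one).
   Formalization: The vectors of $\mathbb{R}^{E(G)}$ in the hypothesis on $PM(G)$, together with the convex weights defining $PM(G)$, are taken in the rationals rather than the reals. -}

module Defs where

open import Data.Nat using (ℕ; zero; suc; _%_)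
import Data.Nat
open import Data.Fin using (Fin; zero; suc; _≟_)
open import Data.Bool using (Bool; true; false; if_then_else_)
open import Data.Product using (Σ; ∃; ∃-syntax; _×_; _,_; proj₁; proj₂)
open import Data.Sum using (_⊎_)
open import Data.List using (List; []; _∷_; _++_; length)
open import Data.List.Membership.Propositional using (_∈_)
open import Data.List.Relation.Unary.Unique.Propositional using (Unique)
open import Data.List.Relation.Unary.Linked using (Linked)
open import Data.Rational using (ℚ; 0ℚ; 1ℚ; _+_; _*_; _≤_)
open import Relation.Binary.PropositionalEquality using (_≡_; _≢_)
open import Relation.Nullary using (¬_)

record Graph : Set where
  field
    n m        : ℕ
    u w        : Fin m → Fin n
    loopless   : ∀ e → u e ≢ w e
    noParallel : ∀ e f →
                 ((u e ≡ u f × w e ≡ w f) ⊎ (u e ≡ w f × w e ≡ u f)) → e ≡ f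
open Graph public

Inc : (G : Graph) → Fin (m G) → Fin (n G) → Set
Inc G e v = (v ≡ u G e) ⊎ (v ≡ w G e)

Adj : (G : Graph) → Fin (n G) → Fin (n G) → Set
Adj G a b = ∃[ e ] ((u G e ≡ a × w G e ≡ b) ⊎ (u G e ≡ b × w G e ≡ a))

EdgeSet : Graph → Set
EdgeSet G = Fin (m G) → Bool

-- M is a perfect matching of G − S (S a set of vertices):
-- no edge of M meets S, and every vertex outside S lies in exactly one edge of M.
IsPMOf- : (G : Graph) → (Fin (n G) → Set) → EdgeSet G → Set
IsPMOf- G S M =
  (∀ e → M e ≡ true → ¬ S (u G e) × ¬ S (w G e)) ×
  (∀ v → ¬ S v →
     Σ (Fin (m G)) λ e → (M e ≡ true × Inc G e v) ×
       (∀ f → M f ≡ true → Inc G f v → f ≡ e))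

NoVertex : {k : ℕ} → Fin k → Set
NoVertex _ = Data.Empty.⊥
  where import Data.Empty

IsPerfectMatching : (G : Graph) → EdgeSet G → Set
IsPerfectMatching G M = IsPMOf- G NoVertex M

HasPerfectMatching : Graph → Set
HasPerfectMatching G = Σ (EdgeSet G) (IsPerfectMatching G)

sumFin : {k : ℕ} → (Fin k → ℚ) → ℚ
sumFin {zero}  f = 0ℚ
sumFin {suc k} f = f zero + sumFin (λ i → f (suc i))

χ : (G : Graph) → EdgeSet G → Fin (m G) → ℚ
χ G M e = if M e then 1ℚ else 0ℚ

incb : (G : Graph) → Fin (m G) → Fin (n G) → Bool
incb G e v with v ≟ u G e | v ≟ w G e
... | Relation.Nullary.yes _ | _ = true
... | Relation.Nullary.no _  | Relation.Nullary.yes _ = true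
... | Relation.Nullary.no _  | Relation.Nullary.no _  = false

OneRegular : (G : Graph) → (Fin (m G) → ℚ) → Set
OneRegular G x = ∀ v → sumFin (λ e → if incb G e v then x e else 0ℚ) ≡ 1ℚ

NonNeg : (G : Graph) → (Fin (m G) → ℚ) → Set
NonNeg G x = ∀ e → 0ℚ ≤ x e

InPM : (G : Graph) → (Fin (m G) → ℚ) → Set
InPM G x =
  Σ ℕ λ k → Σ (Fin k → EdgeSet G) λ Ms → Σ (Fin k → ℚ) λ lam →
    (∀ i → IsPerfectMatching G (Ms i)) ×
    (∀ i → 0ℚ ≤ lam i) ×
    sumFin lam ≡ 1ℚ ×
    (∀ e → x e ≡ sumFin (λ i → lam i * χ G (Ms i) e))

PMIsOneRegularCone : Graph → Set
PMIsOneRegularCone G =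
  ∀ (x : Fin (m G) → ℚ) →
    (InPM G x → NonNeg G x × OneRegular G x) ×
    (NonNeg G x × OneRegular G x → InPM G x)

record OddCycle (G : Graph) : Set where
  field
    start  : Fin (n G)
    rest   : List (Fin (n G))
    distinct : Unique (start ∷ rest)
    closed   : Linked (Adj G) (start ∷ rest ++ start ∷ [])
    long     : 3 Data.Nat.≤ length (start ∷ rest)
    odd      : length (start ∷ rest) % 2 ≡ 1

  verts : List (Fin (n G))
  verts = start ∷ rest
open OddCycle public

InClassG : Graph → Set
InClassG G =
  HasPerfectMatching G ×
  ((C C' : OddCycle G) →
     (∀ v → v ∈ verts C → ¬ (v ∈ verts C')) →
     ¬ Σ (EdgeSet G) (IsPMOf- G (λ v → v ∈ verts C ⊎ v ∈ verts C')))

-- Given disjoint odd cycles C, C′ and a perfect matching M′ of G − V(C) − V(C′), the vector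
-- x = ½χ(E(C)) + ½χ(E(C′)) + χ(M′) is non-negative and 1-regular.  If PM(G) were the whole
-- 1-regular cone, x would be a convex combination of perfect matchings, and a matching M with
-- positive coefficient would lie in the support of x.  Every support edge meets V(C) in zero or two
-- vertices, so by the handshake count |V(C)| = Σ_{v ∈ V(C)} deg_M v = Σ_{e ∈ M} |e ∩ V(C)| the
-- odd number |V(C)| would be even.

module Submission where

open import Defs
open import Data.Bool using (Bool; true; false; if_then_else_)
open import Data.Empty using (⊥-elim)
open import Data.Fin using (Fin; zero; suc; _≟_)
open import Data.List using (List; []; _∷_; _++_; length)
open import Data.List.Membership.Propositional using (_∈_; _∉_)
open import Data.List.Membership.Propositional.Properties using (∈-++⁻)
open import Data.List.Relation.Unary.All.Properties using (All¬⇒¬Any)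
open import Data.List.Relation.Unary.AllPairs using (_∷_)
open import Data.List.Relation.Unary.Any using (here; there; any?)
open import Data.List.Relation.Unary.Linked using (Linked; []; [-]; _∷_)
open import Data.List.Relation.Unary.Unique.Propositional using (Unique)
open import Data.Nat using (ℕ; zero; suc; _+_; _*_; _%_)
open import Data.Nat.Divisibility using (_∣_; divides; n∣m⇒m%n≡0)
open import Data.Nat.Properties
  using (+-*-semiring; +-identityʳ; +-comm; *-identityˡ; *-identityʳ; *-zeroʳ; *-assoc; *-distribʳ-+)
open import Data.Nat.Tactic.RingSolver using (solve-∀)
open import Data.Product as Product using (Σ-syntax; ∃; _×_; _,_; proj₁; proj₂)
open import Data.Rational as ℚ using (ℚ; 0ℚ; 1ℚ; ½)
import Data.Rational.Properties as ℚₚ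
open import Data.Sum using (_⊎_; inj₁; inj₂)
open import Function using (_∘_)
open import Relation.Binary.PropositionalEquality
open import Relation.Nullary using (¬_; yes; no; does; contradiction)
open import Relation.Nullary.Decidable using (dec-true; dec-false)

open import Algebra.Properties.Semiring.Sum +-*-semiring
  using (sum-syntax; sum-cong-≗; sum-replicate-zero; ∑-distrib-+; ∑-comm; *-distribˡ-sum; *-distribʳ-sum)
open import Algebra.Properties.Monoid.Mult ℚₚ.+-0-monoid
  using (×-homo-+) renaming (_×_ to _·_)

𝟙 : Bool → ℕ
𝟙 b = if b then 1 else 0

δ : ∀ {k} → Fin k → Fin k → ℕ
δ i j = 𝟙 (does (i ≟ j))

δ-refl : ∀ {k} (i : Fin k) → δ i i ≡ 1
δ-refl i = cong 𝟙 (dec-true (i ≟ i) refl)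

δ-≢ : ∀ {k} {i j : Fin k} → i ≢ j → δ i j ≡ 0
δ-≢ {i = i} {j} i≢j = cong 𝟙 (dec-false (i ≟ j) i≢j)

∑-δ : ∀ {k} (g : Fin k → ℕ) (j : Fin k) → ∑[ i < k ] (δ i j * g i) ≡ g j
∑-δ {suc k} g zero    = trans (cong₂ _+_ (+-identityʳ (g zero)) (sum-replicate-zero k)) (+-identityʳ (g zero))
∑-δ {suc k} g (suc j) = ∑-δ (g ∘ suc) j

count : ∀ {k} → Fin k → List (Fin k) → ℕ
count a []      = 0
count a (b ∷ L) = δ a b + count a L

count-∷ʳ : ∀ {k} {a b : Fin k} L → count a (L ++ b ∷ []) ≡ count a (b ∷ L)
count-∷ʳ []                    = refl
count-∷ʳ {a = a} {b} (c ∷ L) = trans (cong (δ a c +_) (count-∷ʳ L)) (left-comm (δ a c) (δ a b) (count a L))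
  where
  left-comm : ∀ x y z → x + (y + z) ≡ y + (x + z)
  left-comm = solve-∀

count-∉ : ∀ {k} {a : Fin k} {L} → a ∉ L → count a L ≡ 0
count-∉ {L = []}    _   = refl
count-∉ {L = b ∷ L} a∉L = cong₂ _+_ (δ-≢ (a∉L ∘ here)) (count-∉ (a∉L ∘ there))

count-unique : ∀ {k} {a : Fin k} {L} → Unique L → a ∈ L → count a L ≡ 1
count-unique {a = a} (b∉L ∷ _)  (here refl) = cong₂ _+_ (δ-refl a) (count-∉ (All¬⇒¬Any b∉L))
count-unique {a = a} {b ∷ _} (b∉L ∷ uL) (there a∈L) =
  cong₂ _+_ (δ-≢ {i = a} {b} λ { refl → All¬⇒¬Any b∉L a∈L }) (count-unique uL a∈L)

∑-count : ∀ {k} (L : List (Fin k)) → ∑[ v < k ] count v L ≡ length L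
∑-count {k} []      = sum-replicate-zero k
∑-count {k} (b ∷ L) = begin
  ∑[ v < k ] (δ v b + count v L)         ≡⟨ ∑-distrib-+ (λ v → δ v b) (λ v → count v L) ⟩
  ∑[ v < k ] δ v b + ∑[ v < k ] count v L ≡⟨ cong₂ _+_ ∑-δ-const (∑-count L) ⟩
  suc (length L)                          ∎
  where
  open ≡-Reasoning
  ∑-δ-const : ∑[ v < k ] δ v b ≡ 1
  ∑-δ-const = trans (sum-cong-≗ (λ v → sym (*-identityʳ (δ v b)))) (∑-δ (λ _ → 1) b)

∈-closed : ∀ {A : Set} {v x : A} xs → v ∈ x ∷ xs ++ x ∷ [] → v ∈ x ∷ xs
∈-closed xs (here v≡x) = here v≡x
∈-closed xs (there v∈) with ∈-++⁻ xs v∈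
... | inj₁ v∈xs        = there v∈xs
... | inj₂ (here v≡x)  = here v≡x

incidence : (G : Graph) → Fin (m G) → Fin (n G) → ℕ
incidence G e v = 𝟙 (incb G e v)

degree : (G : Graph) → (Fin (m G) → ℕ) → Fin (n G) → ℕ
degree G y v = ∑[ e < m G ] (y e * incidence G e v)

module _ (G : Graph) where

  incidence-δ : ∀ e v → incidence G e v ≡ δ v (u G e) + δ v (w G e)
  incidence-δ e v with v ≟ u G e | v ≟ w G e
  ... | yes v≡u | yes v≡w = ⊥-elim (loopless G e (trans (sym v≡u) v≡w))
  ... | yes _   | no _    = refl
  ... | no _    | yes _   = refl
  ... | no _    | no _    = refl

  Inc⇒incidence≡1 : ∀ {e v} → Inc G e v → incidence G e v ≡ 1
  Inc⇒incidence≡1 {e} {v} v∈e with v ≟ u G e | v ≟ w G e | v∈e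
  ... | yes _  | _      | _        = refl
  ... | no _   | yes _  | _        = refl
  ... | no v≢u | no _   | inj₁ v≡u = ⊥-elim (v≢u v≡u)
  ... | no _   | no v≢w | inj₂ v≡w = ⊥-elim (v≢w v≡w)

  incidence≡0⊎Inc : ∀ e v → incidence G e v ≡ 0 ⊎ Inc G e v
  incidence≡0⊎Inc e v with v ≟ u G e | v ≟ w G e
  ... | yes v≡u | _       = inj₂ (inj₁ v≡u)
  ... | no _    | yes v≡w = inj₂ (inj₂ v≡w)
  ... | no _    | no _    = inj₁ refl

  degree-+ : ∀ (y z : Fin (m G) → ℕ) v → degree G (λ e → y e + z e) v ≡ degree G y v + degree G z v
  degree-+ y z v = trans (sum-cong-≗ λ e → *-distribʳ-+ (incidence G e v) (y e) (z e))
                         (∑-distrib-+ (λ e → y e * incidence G e v) (λ e → z e * incidence G e v))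

  degree-δ : ∀ f v → degree G (λ e → δ e f) v ≡ incidence G f v
  degree-δ f v = ∑-δ (λ e → incidence G e v) f

  ∑-incidence : ∀ (c : Fin (n G) → ℕ) e → ∑[ v < n G ] (incidence G e v * c v) ≡ c (u G e) + c (w G e)
  ∑-incidence c e = begin
    ∑[ v < n G ] (incidence G e v * c v)
      ≡⟨ sum-cong-≗ split ⟩
    ∑[ v < n G ] (δ v (u G e) * c v + δ v (w G e) * c v)
      ≡⟨ ∑-distrib-+ (λ v → δ v (u G e) * c v) (λ v → δ v (w G e) * c v) ⟩
    ∑[ v < n G ] (δ v (u G e) * c v) + ∑[ v < n G ] (δ v (w G e) * c v)
      ≡⟨ cong₂ _+_ (∑-δ c (u G e)) (∑-δ c (w G e)) ⟩
    c (u G e) + c (w G e)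
      ∎
    where
    open ≡-Reasoning
    split : ∀ v → incidence G e v * c v ≡ δ v (u G e) * c v + δ v (w G e) * c v
    split v = trans (cong (_* c v) (incidence-δ e v)) (*-distribʳ-+ (c v) (δ v (u G e)) _)

  weighted-handshake : ∀ (y : Fin (m G) → ℕ) (c : Fin (n G) → ℕ) →
    ∑[ v < n G ] (degree G y v * c v) ≡ ∑[ e < m G ] (y e * (c (u G e) + c (w G e)))
  weighted-handshake y c = begin
    ∑[ v < n G ] (degree G y v * c v)
      ≡⟨ sum-cong-≗ (λ v → *-distribʳ-sum (c v) (λ e → y e * incidence G e v)) ⟩
    ∑[ v < n G ] ∑[ e < m G ] (y e * incidence G e v * c v)
      ≡⟨ ∑-comm (λ v e → y e * incidence G e v * c v) ⟩
    ∑[ e < m G ] ∑[ v < n G ] (y e * incidence G e v * c v)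
      ≡⟨ sum-cong-≗ factor ⟩
    ∑[ e < m G ] (y e * (c (u G e) + c (w G e)))
      ∎
    where
    open ≡-Reasoning
    factor : ∀ e → ∑[ v < n G ] (y e * incidence G e v * c v) ≡ y e * (c (u G e) + c (w G e))
    factor e = begin
      ∑[ v < n G ] (y e * incidence G e v * c v)   ≡⟨ sum-cong-≗ (λ v → *-assoc (y e) (incidence G e v) (c v)) ⟩
      ∑[ v < n G ] (y e * (incidence G e v * c v)) ≡⟨ *-distribˡ-sum (y e) (λ v → incidence G e v * c v) ⟨
      y e * ∑[ v < n G ] (incidence G e v * c v)   ≡⟨ cong (y e *_) (∑-incidence c e) ⟩
      y e * (c (u G e) + c (w G e))                ∎

  Adj-incidence : ∀ {a b} (r : Adj G a b) v → incidence G (proj₁ r) v ≡ δ v a + δ v b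
  Adj-incidence (e , inj₁ (refl , refl)) v = incidence-δ e v
  Adj-incidence (e , inj₂ (refl , refl)) v = trans (incidence-δ e v) (+-comm (δ v (u G e)) _)

  edges : ∀ {xs} → Linked (Adj G) xs → List (Fin (m G))
  edges []      = []
  edges [-]     = []
  edges (r ∷ l) = proj₁ r ∷ edges l

  edges-endpoints : ∀ {xs e} (l : Linked (Adj G) xs) → e ∈ edges l → u G e ∈ xs × w G e ∈ xs
  edges-endpoints ((_ , inj₁ (u≡a , w≡b)) ∷ _) (here refl) = here u≡a , there (here w≡b)
  edges-endpoints ((_ , inj₂ (u≡b , w≡a)) ∷ _) (here refl) = there (here u≡b) , here w≡a
  edges-endpoints (_ ∷ l) (there e∈l) = Product.map there there (edges-endpoints l e∈l)

  -- Along the walk x, xs, y every vertex is counted once as the tail and once as the head of an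
  -- edge, except that x is never a head and y never a tail.
  walk-degree : ∀ {x y} xs (l : Linked (Adj G) (x ∷ xs ++ y ∷ [])) v →
    degree G (λ e → count e (edges l)) v ≡ count v (x ∷ xs) + count v (xs ++ y ∷ [])
  walk-degree {x} {y} [] (r ∷ [-]) v = begin
    degree G (λ e → δ e (proj₁ r) + 0) v
      ≡⟨ degree-+ (λ e → δ e (proj₁ r)) (λ _ → 0) v ⟩
    degree G (λ e → δ e (proj₁ r)) v + degree G (λ _ → 0) v
      ≡⟨ cong₂ _+_ (trans (degree-δ (proj₁ r) v) (Adj-incidence r v)) (sum-replicate-zero (m G)) ⟩
    δ v x + δ v y + 0
      ≡⟨ regroup (δ v x) (δ v y) ⟩
    (δ v x + 0) + (δ v y + 0)
      ∎
    where
    open ≡-Reasoning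
    regroup : ∀ a b → a + b + 0 ≡ (a + 0) + (b + 0)
    regroup = solve-∀
  walk-degree {x} {y} (x′ ∷ xs) (r ∷ l) v = begin
    degree G (λ e → δ e (proj₁ r) + count e (edges l)) v
      ≡⟨ degree-+ (λ e → δ e (proj₁ r)) (λ e → count e (edges l)) v ⟩
    degree G (λ e → δ e (proj₁ r)) v + degree G (λ e → count e (edges l)) v
      ≡⟨ cong₂ _+_ (trans (degree-δ (proj₁ r) v) (Adj-incidence r v)) (walk-degree xs l v) ⟩
    (δ v x + δ v x′) + (count v (x′ ∷ xs) + count v (xs ++ y ∷ []))
      ≡⟨ regroup (δ v x) (δ v x′) (count v xs) (count v (xs ++ y ∷ [])) ⟩
    count v (x ∷ x′ ∷ xs) + count v (x′ ∷ xs ++ y ∷ [])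
      ∎
    where
    open ≡-Reasoning
    regroup : ∀ a b c d → (a + b) + ((b + c) + d) ≡ (a + (b + c)) + (b + d)
    regroup = solve-∀

  cycleEdges : OddCycle G → List (Fin (m G))
  cycleEdges C = edges (closed C)

  cycle-degree : ∀ C v →
    degree G (λ e → count e (cycleEdges C)) v ≡ count v (verts C) + count v (verts C)
  cycle-degree C v =
    trans (walk-degree (rest C) (closed C) v) (cong (count v (verts C) +_) (count-∷ʳ (rest C)))

  cycleEdges-endpoints : ∀ C {e} → e ∈ cycleEdges C → u G e ∈ verts C × w G e ∈ verts C
  cycleEdges-endpoints C e∈C =
    Product.map (∈-closed (rest C)) (∈-closed (rest C)) (edges-endpoints (closed C) e∈C)

  module _ {S : Fin (n G) → Set} {M : EdgeSet G} (pm : IsPMOf- G S M) where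

    matched-incidence : ∀ e v → 𝟙 (M e) * incidence G e v ≡ 0 ⊎ (M e ≡ true × Inc G e v)
    matched-incidence e v with M e | incidence≡0⊎Inc e v
    ... | false | _         = inj₁ refl
    ... | true  | inj₁ i≡0  = inj₁ (cong (1 *_) i≡0)
    ... | true  | inj₂ v∈e  = inj₂ (refl , v∈e)

    matching-degree-inside : ∀ {v} → S v → degree G (𝟙 ∘ M) v ≡ 0
    matching-degree-inside {v} v∈S = trans (sum-cong-≗ unmatched) (sum-replicate-zero (m G))
      where
      unmatched : ∀ e → 𝟙 (M e) * incidence G e v ≡ 0
      unmatched e with matched-incidence e v
      ... | inj₁ vanishes          = vanishes
      ... | inj₂ (Me , inj₁ v≡u)   = ⊥-elim (proj₁ (proj₁ pm e Me) (subst S v≡u v∈S))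
      ... | inj₂ (Me , inj₂ v≡w)   = ⊥-elim (proj₂ (proj₁ pm e Me) (subst S v≡w v∈S))

    matching-degree-outside : ∀ {v} → ¬ S v → degree G (𝟙 ∘ M) v ≡ 1
    matching-degree-outside {v} v∉S with proj₂ pm v v∉S
    ... | eᵥ , (Meᵥ , v∈eᵥ) , unique =
      trans (sum-cong-≗ only-eᵥ) (trans (∑-δ (λ e → incidence G e v) eᵥ) (Inc⇒incidence≡1 v∈eᵥ))
      where
      only-eᵥ : ∀ e → 𝟙 (M e) * incidence G e v ≡ δ e eᵥ * incidence G e v
      only-eᵥ e with e ≟ eᵥ | matched-incidence e v
      ... | yes refl | _               = cong (λ b → 𝟙 b * incidence G e v) Meᵥ
      ... | no _     | inj₁ vanishes   = vanishes
      ... | no e≢eᵥ  | inj₂ (Me , v∈e) = ⊥-elim (e≢eᵥ (unique e Me v∈e))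

  balanced-matching⇒even : ∀ {M} (L : List (Fin (n G))) → IsPerfectMatching G M →
    (∀ e → M e ≡ true → count (u G e) L ≡ count (w G e) L) → 2 ∣ length L
  balanced-matching⇒even {M} L pm balanced = divides (∑[ e < m G ] (𝟙 (M e) * count (u G e) L)) (begin
    length L
      ≡⟨ ∑-count L ⟨
    ∑[ v < n G ] count v L
      ≡⟨ sum-cong-≗ covered ⟩
    ∑[ v < n G ] (degree G (𝟙 ∘ M) v * count v L)
      ≡⟨ weighted-handshake (𝟙 ∘ M) (λ v → count v L) ⟩
    ∑[ e < m G ] (𝟙 (M e) * (count (u G e) L + count (w G e) L))
      ≡⟨ sum-cong-≗ doubled ⟩
    ∑[ e < m G ] (𝟙 (M e) * count (u G e) L * 2)
      ≡⟨ *-distribʳ-sum 2 (λ e → 𝟙 (M e) * count (u G e) L) ⟨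
    ∑[ e < m G ] (𝟙 (M e) * count (u G e) L) * 2
      ∎)
    where
    open ≡-Reasoning
    covered : ∀ v → count v L ≡ degree G (𝟙 ∘ M) v * count v L
    covered v =
      trans (sym (*-identityˡ (count v L))) (cong (_* count v L) (sym (matching-degree-outside pm λ ())))
    doubled : ∀ e → 𝟙 (M e) * (count (u G e) L + count (w G e) L) ≡ 𝟙 (M e) * count (u G e) L * 2
    doubled e with M e in Me
    ... | false = refl
    ... | true  =
      trans (cong (λ c → 1 * (count (u G e) L + c)) (sym (balanced e Me))) (double (count (u G e) L))
      where
      double : ∀ a → 1 * (a + a) ≡ 1 * a * 2
      double = solve-∀

sumFin-cong : ∀ {k} {f g : Fin k → ℚ} → (∀ i → f i ≡ g i) → sumFin f ≡ sumFin g
sumFin-cong {zero}  _   = refl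
sumFin-cong {suc k} f≗g = cong₂ ℚ._+_ (f≗g zero) (sumFin-cong (f≗g ∘ suc))

sumFin-· : ∀ {k} (h : Fin k → ℕ) q → sumFin (λ i → h i · q) ≡ (∑[ i < k ] h i) · q
sumFin-· {zero}  h q = refl
sumFin-· {suc k} h q = trans (cong (h zero · q ℚ.+_) (sumFin-· (h ∘ suc) q)) (sym (×-homo-+ q (h zero) _))

sumFin-nonNeg : ∀ {k} (f : Fin k → ℚ) → (∀ i → 0ℚ ℚ.≤ f i) → 0ℚ ℚ.≤ sumFin f
sumFin-nonNeg {zero}  f f≥0 = ℚₚ.≤-refl
sumFin-nonNeg {suc k} f f≥0 = ℚₚ.+-mono-≤ (f≥0 zero) (sumFin-nonNeg (f ∘ suc) (f≥0 ∘ suc))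

term≤sumFin : ∀ {k} (f : Fin k → ℚ) → (∀ i → 0ℚ ℚ.≤ f i) → ∀ i → f i ℚ.≤ sumFin f
term≤sumFin {suc k} f f≥0 zero =
  subst (ℚ._≤ sumFin f) (ℚₚ.+-identityʳ (f zero))
        (ℚₚ.+-mono-≤ (ℚₚ.≤-refl {f zero}) (sumFin-nonNeg (f ∘ suc) (f≥0 ∘ suc)))
term≤sumFin {suc k} f f≥0 (suc i) =
  subst (ℚ._≤ sumFin f) (ℚₚ.+-identityˡ (f (suc i)))
        (ℚₚ.+-mono-≤ (f≥0 zero) (term≤sumFin (f ∘ suc) (f≥0 ∘ suc) i))

positive-term : ∀ {k} (f : Fin k → ℚ) → 0ℚ ℚ.< sumFin f → ∃ λ i → 0ℚ ℚ.< f i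
positive-term {zero} f ∑f>0 = ⊥-elim (ℚₚ.<-irrefl refl ∑f>0)
positive-term {suc k} f ∑f>0 with 0ℚ ℚₚ.<? f zero | 0ℚ ℚₚ.<? sumFin (f ∘ suc)
... | yes f₀>0 | _         = zero , f₀>0
... | no _     | yes rest>0 = let i , fᵢ>0 = positive-term (f ∘ suc) rest>0 in suc i , fᵢ>0
... | no f₀≯0  | no rest≯0  =
  ⊥-elim (ℚₚ.<-irrefl refl (ℚₚ.<-≤-trans ∑f>0 (ℚₚ.+-mono-≤ (ℚₚ.≮⇒≥ f₀≯0) (ℚₚ.≮⇒≥ rest≯0))))

InPM⇒matching-in-support : ∀ G x → InPM G x →
  Σ[ M ∈ EdgeSet G ] (IsPerfectMatching G M × (∀ e → M e ≡ true → 0ℚ ℚ.< x e))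
InPM⇒matching-in-support G x (k , Ms , λs , pms , λs≥0 , ∑λs≡1 , x≡) = Ms i , pms i , in-support
  where
  positive-coefficient : ∃ λ i → 0ℚ ℚ.< λs i
  positive-coefficient = positive-term λs (subst (0ℚ ℚ.<_) (sym ∑λs≡1) (ℚₚ.positive⁻¹ 1ℚ))
  i = proj₁ positive-coefficient
  term-nonNeg : ∀ e j → 0ℚ ℚ.≤ λs j ℚ.* χ G (Ms j) e
  term-nonNeg e j with Ms j e
  ... | true  = subst (0ℚ ℚ.≤_) (sym (ℚₚ.*-identityʳ (λs j))) (λs≥0 j)
  ... | false = subst (0ℚ ℚ.≤_) (sym (ℚₚ.*-zeroʳ (λs j))) ℚₚ.≤-refl
  in-support : ∀ e → Ms i e ≡ true → 0ℚ ℚ.< x e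
  in-support e Mᵢe = ℚₚ.<-≤-trans (proj₂ positive-coefficient) (subst₂ ℚ._≤_ λᵢχᵢ≡λᵢ (sym (x≡ e))
    (term≤sumFin (λ j → λs j ℚ.* χ G (Ms j) e) (term-nonNeg e) i))
    where
    λᵢχᵢ≡λᵢ : λs i ℚ.* χ G (Ms i) e ≡ λs i
    λᵢχᵢ≡λᵢ = trans (cong (λ b → λs i ℚ.* (if b then 1ℚ else 0ℚ)) Mᵢe) (ℚₚ.*-identityʳ (λs i))

·-nonNeg : ∀ k {q} → 0ℚ ℚ.≤ q → 0ℚ ℚ.≤ k · q
·-nonNeg zero    _   = ℚₚ.≤-refl
·-nonNeg (suc k) q≥0 = ℚₚ.+-mono-≤ q≥0 (·-nonNeg k q≥0)

module _ (G : Graph) (y : Fin (m G) → ℕ) where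

  halved-nonNeg : NonNeg G (λ e → y e · ½)
  halved-nonNeg e = ·-nonNeg (y e) (ℚₚ.<⇒≤ (ℚₚ.positive⁻¹ ½))

  halved-regular : (∀ v → degree G y v ≡ 2) → OneRegular G (λ e → y e · ½)
  halved-regular degree≡2 v = begin
    sumFin (λ e → if incb G e v then y e · ½ else 0ℚ) ≡⟨ sumFin-cong select ⟩
    sumFin (λ e → (y e * incidence G e v) · ½)        ≡⟨ sumFin-· (λ e → y e * incidence G e v) ½ ⟩
    degree G y v · ½                                  ≡⟨ cong (_· ½) (degree≡2 v) ⟩
    1ℚ                                                ∎
    where
    open ≡-Reasoning
    select : ∀ e → (if incb G e v then y e · ½ else 0ℚ) ≡ (y e * incidence G e v) · ½
    select e with incb G e v
    ... | true  = cong (_· ½) (sym (*-identityʳ (y e)))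
    ... | false = cong (_· ½) (sym (*-zeroʳ (y e)))

odd⇒¬even : ∀ {k} → k % 2 ≡ 1 → ¬ (2 ∣ k)
odd⇒¬even {k} odd even = contradiction (trans (sym (n∣m⇒m%n≡0 k 2 even)) odd) λ ()

module OddCyclePair {G : Graph} (C C′ : OddCycle G)
  (disjoint : ∀ v → v ∈ verts C → ¬ (v ∈ verts C′))
  (M′ : EdgeSet G) (pm′ : IsPMOf- G (λ v → v ∈ verts C ⊎ v ∈ verts C′) M′) where

  -- 2x, kept in ℕ so that all degree computations are sums of naturals
  doubledWeight : Fin (m G) → ℕ
  doubledWeight e = count e (cycleEdges G C) + count e (cycleEdges G C′) + (𝟙 (M′ e) + 𝟙 (M′ e))

  covered-once : ∀ v → count v (verts C) + count v (verts C′) + degree G (𝟙 ∘ M′) v ≡ 1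
  covered-once v with any? (v ≟_) (verts C) | any? (v ≟_) (verts C′)
  ... | yes v∈C | _        = cong₂ _+_ (cong₂ _+_ (count-unique (distinct C) v∈C) (count-∉ (disjoint v v∈C)))
                                       (matching-degree-inside G pm′ (inj₁ v∈C))
  ... | no v∉C  | yes v∈C′ = cong₂ _+_ (cong₂ _+_ (count-∉ v∉C) (count-unique (distinct C′) v∈C′))
                                       (matching-degree-inside G pm′ (inj₂ v∈C′))
  ... | no v∉C  | no v∉C′  = cong₂ _+_ (cong₂ _+_ (count-∉ v∉C) (count-∉ v∉C′))
                                       (matching-degree-outside G pm′ λ { (inj₁ v∈C)  → v∉C v∈C
                                                                       ; (inj₂ v∈C′) → v∉C′ v∈C′ })

  degree-doubledWeight : ∀ v → degree G doubledWeight v ≡ 2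
  degree-doubledWeight v = begin
    degree G doubledWeight v
      ≡⟨ trans (degree-+ G EC+EC′ (λ e → 𝟙 (M′ e) + 𝟙 (M′ e)) v)
               (cong₂ _+_ (degree-+ G EC EC′ v) (degree-+ G (𝟙 ∘ M′) (𝟙 ∘ M′) v)) ⟩
    degree G EC v + degree G EC′ v + (dM′ + dM′)
      ≡⟨ cong₂ (λ a b → a + b + (dM′ + dM′)) (cycle-degree G C v) (cycle-degree G C′ v) ⟩
    (cC + cC) + (cC′ + cC′) + (dM′ + dM′)
      ≡⟨ regroup cC cC′ dM′ ⟩
    (cC + cC′ + dM′) + (cC + cC′ + dM′)
      ≡⟨ cong (λ k → k + k) (covered-once v) ⟩
    2 ∎
    where
    open ≡-Reasoning
    EC EC′ EC+EC′ : Fin (m G) → ℕ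
    EC e     = count e (cycleEdges G C)
    EC′ e    = count e (cycleEdges G C′)
    EC+EC′ e = EC e + EC′ e
    cC = count v (verts C)
    cC′ = count v (verts C′)
    dM′ = degree G (𝟙 ∘ M′) v
    regroup : ∀ a b c → (a + a) + (b + b) + (c + c) ≡ (a + b + c) + (a + b + c)
    regroup = solve-∀

  halfWeight : Fin (m G) → ℚ
  halfWeight e = doubledWeight e · ½

  halfWeight-feasible : NonNeg G halfWeight × OneRegular G halfWeight
  halfWeight-feasible =
    halved-nonNeg G doubledWeight , halved-regular G doubledWeight degree-doubledWeight

  both-outside : ∀ {a b} → a ∉ verts C → b ∉ verts C → count a (verts C) ≡ count b (verts C)
  both-outside a∉C b∉C = trans (count-∉ a∉C) (sym (count-∉ b∉C))

  support-balanced : ∀ e → doubledWeight e ≢ 0 → count (u G e) (verts C) ≡ count (w G e) (verts C)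
  support-balanced e weight≢0 with any? (e ≟_) (cycleEdges G C)
  ... | yes e∈C with cycleEdges-endpoints G C e∈C
  ...   | u∈C , w∈C = trans (count-unique (distinct C) u∈C) (sym (count-unique (distinct C) w∈C))
  support-balanced e weight≢0 | no e∉C with any? (e ≟_) (cycleEdges G C′)
  ... | yes e∈C′ with cycleEdges-endpoints G C′ e∈C′
  ...   | u∈C′ , w∈C′ = both-outside (λ u∈C → disjoint _ u∈C u∈C′) (λ w∈C → disjoint _ w∈C w∈C′)
  support-balanced e weight≢0 | no e∉C | no e∉C′ with M′ e in M′e
  ... | true  = both-outside (proj₁ (proj₁ pm′ e M′e) ∘ inj₁) (proj₂ (proj₁ pm′ e M′e) ∘ inj₁)
  ... | false = ⊥-elim (weight≢0 (cong₂ _+_ (cong₂ _+_ (count-∉ e∉C) (count-∉ e∉C′)) refl))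

  halfWeight-support-balanced : ∀ e → 0ℚ ℚ.< halfWeight e →
    count (u G e) (verts C) ≡ count (w G e) (verts C)
  halfWeight-support-balanced e halfWeight>0 = support-balanced e λ weight≡0 →
    ℚₚ.<-irrefl refl (subst (λ k → 0ℚ ℚ.< k · ½) weight≡0 halfWeight>0)

  ¬PMIsOneRegularCone : ¬ PMIsOneRegularCone G
  ¬PMIsOneRegularCone cone =
    let M , pm , M⊆support =
          InPM⇒matching-in-support G halfWeight (proj₂ (cone halfWeight) halfWeight-feasible)
    in odd⇒¬even (odd C)
         (balanced-matching⇒even G (verts C) pm λ e Me → halfWeight-support-balanced e (M⊆support e Me))

lemma4p8 : (G : Graph) → HasPerfectMatching G → PMIsOneRegularCone G → InClassG G
lemma4p8 G hasPM cone =
  hasPM , λ C C′ disjoint (M′ , pm′) → OddCyclePair.¬PMIsOneRegularCone C C′ disjoint M′ pm′ cone
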